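{- Let $(G_j)_{j\in\mathbb Z}$ and $(H_j)_{j\in\mathbb Z}$ be gibonacci sequences. For all integers $r$ and $k$, $$2\left(H_rG_k^3+H_{r+1}G_{k+1}^3+H_{r+2}G_{k+2}^3\right)=\left(G_k^2+G_{k+1}^2+G_{k+2}^2\right)\left(H_rG_k+H_{r+1}G_{k+1}+H_{r+2}G_{k+2}\right).$$
   Context: A gibonacci sequence is a sequence $(G_j)_{j\in\mathbb Z}$ with arbitrary initial values $G_0,G_1$, not both zero, satisfying $G_j=G_{j-1}+G_{j-2}$ for all integers $j$; similarly for $(H_j)$ with seeds $H_0,H_1$. -}

module Defs where

open import Level using (Level)
open import Algebra.Bundles using (CommutativeRing)
open import Data.Integer as ℤ using (ℤ; +_)
open import Data.Product using (_×_)
open import Relation.Nullary using (¬_)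

module _ {c ℓ : Level} (R : CommutativeRing c ℓ) where
  open CommutativeRing R

  record IsGibonacci (G : ℤ → Carrier) : Set (c Level.⊔ ℓ) where
    field
      recurrence : ∀ (j : ℤ) → G j ≈ G (j ℤ.- + 1) + G (j ℤ.- + 2)
      nontrivial : ¬ ((G (+ 0) ≈ 0#) × (G (+ 1) ≈ 0#))

-- Proof idea: both sides are polynomials in four quantities only, since
-- G (k+2) = G k + G (k+1) and H (r+2) = H r + H (r+1); after this
-- substitution the claim is a polynomial identity in G k, G (k+1), H r, H (r+1).
module Submission where

open import Defs
open import Level using (Level)
open import Algebra.Bundles using (CommutativeRing; CommutativeSemiring)
open import Data.Integer as ℤ using (ℤ; +_)
open import Data.Integer.Properties using (+-assoc; +-identityʳ)
open import Relation.Binary.PropositionalEquality as ≡ using (_≡_)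
import Algebra.Solver.Ring.NaturalCoefficients.Default as Solver
import Relation.Binary.Reasoning.Setoid as SetoidReasoning

+2-1≡+1 : ∀ j → (j ℤ.+ + 2) ℤ.- + 1 ≡ j ℤ.+ + 1
+2-1≡+1 j = +-assoc j (+ 2) (ℤ.- + 1)

+2-2≡id : ∀ j → (j ℤ.+ + 2) ℤ.- + 2 ≡ j
+2-2≡id j = ≡.trans (+-assoc j (+ 2) (ℤ.- + 2)) (+-identityʳ j)

module _ {c ℓ : Level} (S : CommutativeSemiring c ℓ) where
  open CommutativeSemiring S
  open Solver S

  cubic-sum-identity : ∀ a b x y →
    (1# + 1#) * (x * (a * a * a) + y * (b * b * b) + (x + y) * ((a + b) * (a + b) * (a + b)))
      ≈ (a * a + b * b + (a + b) * (a + b)) * (x * a + y * b + (x + y) * (a + b))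
  cubic-sum-identity = solve 4 (λ a b x y →
    (con 1 :+ con 1) :* (x :* (a :* a :* a) :+ y :* (b :* b :* b)
                         :+ (x :+ y) :* ((a :+ b) :* (a :+ b) :* (a :+ b)))
      := (a :* a :+ b :* b :+ (a :+ b) :* (a :+ b)) :* (x :* a :+ y :* b :+ (x :+ y) :* (a :+ b)))
    refl

module _ {c ℓ : Level} (R : CommutativeRing c ℓ) where
  open CommutativeRing R

  gibonacci-step : ∀ {G : ℤ → Carrier} → IsGibonacci R G →
    ∀ j → G (j ℤ.+ + 2) ≈ G j + G (j ℤ.+ + 1)
  gibonacci-step {G} isG j = begin
    G (j ℤ.+ + 2)                                 ≈⟨ IsGibonacci.recurrence isG (j ℤ.+ + 2) ⟩
    G ((j ℤ.+ + 2) ℤ.- + 1) + G ((j ℤ.+ + 2) ℤ.- + 2)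
      ≡⟨ ≡.cong₂ (λ u v → G u + G v) (+2-1≡+1 j) (+2-2≡id j) ⟩
    G (j ℤ.+ + 1) + G j                           ≈⟨ +-comm _ _ ⟩
    G j + G (j ℤ.+ + 1)                           ∎
    where open SetoidReasoning setoid

proposition30 : ∀ {c ℓ : Level} (R : CommutativeRing c ℓ) →
    let open CommutativeRing R in
    (G H : ℤ → Carrier) → IsGibonacci R G → IsGibonacci R H →
    ∀ (r k : ℤ) →
    (1# + 1#) * (H r * (G k * G k * G k)
    + H (r ℤ.+ + 1) * (G (k ℤ.+ + 1) * G (k ℤ.+ + 1) * G (k ℤ.+ + 1))
    + H (r ℤ.+ + 2) * (G (k ℤ.+ + 2) * G (k ℤ.+ + 2) * G (k ℤ.+ + 2)))
    ≈ (G k * G k + G (k ℤ.+ + 1) * G (k ℤ.+ + 1) + G (k ℤ.+ + 2) * G (k ℤ.+ + 2))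
    * (H r * G k + H (r ℤ.+ + 1) * G (k ℤ.+ + 1) + H (r ℤ.+ + 2) * G (k ℤ.+ + 2))
proposition30 R G H isG isH r k = begin
  (1# + 1#) * (x * (a * a * a) + y * (b * b * b) + H (r ℤ.+ + 2) * (c * c * c))
    ≈⟨ *-congˡ (+-congˡ (*-cong z≈x+y (*-cong (*-cong c≈a+b c≈a+b) c≈a+b))) ⟩
  (1# + 1#) * (x * (a * a * a) + y * (b * b * b) + (x + y) * ((a + b) * (a + b) * (a + b)))
    ≈⟨ cubic-sum-identity commutativeSemiring a b x y ⟩
  (a * a + b * b + (a + b) * (a + b)) * (x * a + y * b + (x + y) * (a + b))
    ≈⟨ sym (*-cong (+-congˡ (*-cong c≈a+b c≈a+b)) (+-congˡ (*-cong z≈x+y c≈a+b))) ⟩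
  (a * a + b * b + c * c) * (x * a + y * b + H (r ℤ.+ + 2) * c) ∎
  where
  open CommutativeRing R
  open SetoidReasoning setoid
  a b c x y : Carrier
  a = G k
  b = G (k ℤ.+ + 1)
  c = G (k ℤ.+ + 2)
  x = H r
  y = H (r ℤ.+ + 1)

  c≈a+b : c ≈ a + b
  c≈a+b = gibonacci-step R isG k

  z≈x+y : H (r ℤ.+ + 2) ≈ x + y
  z≈x+y = gibonacci-step R isH r
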